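{- Let $(G,w)$ be an undirected weighted graph with adjacency matrix $A$, and let $G^{\#}$ denote its group inverse graph. (a) If $G$ is connected, then $G^{\#}$ is connected. (b) If $G$ is bipartite, then $G^{\#}$ is bipartite.
   Context: An undirected weighted graph $(G,w)$ on vertices $v_1,\dots,v_n$ is a graph $G$ together with a function $w$ assigning a nonzero real weight to each edge. Its adjacency matrix $A=(a_{ij})$ is the $n\times n$ real symmetric matrix with $a_{ij}=w(v_iv_j)$ if $v_iv_j$ is an edge and $a_{ij}=0$ otherwise. The group inverse of a square matrix $A$ is the unique matrix $X$ with $AXA=A$, $XAX=X$, $AX=XA$; it is denoted $A^{\#}$ and always exists for real symmetric $A$. The group inverse graph $G^{\#}$ of $(G,w)$ is the weighted graph on the same vertex set in which $v_iv_j$ is an edge if and only if the $(i,j)$ entry of $A^{\#}$ is nonzero, with weight equal to that entry (i.e. $G^{\#}$ is the weighted graph whose adjacency matrix is $A^{\#}$). -}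

module Defs where

open import Level using (Level; _⊔_) renaming (suc to lsuc)
open import Algebra.Bundles using (CommutativeRing)
open import Relation.Binary.Structures using (IsTotalOrder)
open import Relation.Nullary using (¬_)
open import Relation.Binary.PropositionalEquality using (_≡_; _≢_)
open import Data.Product using (Σ; ∃; _×_; _,_)
open import Data.Nat using (ℕ)
import Data.Nat as ℕ
open import Data.Fin using (Fin)
import Data.Fin as Fin
open import Data.Bool using (Bool)

-- An axiomatisation of the real numbers: a Dedekind-complete ordered field.
-- (Agda's standard library has no real numbers; any model of this record is
-- isomorphic to ℝ, so quantifying over all models is the same as speaking of ℝ.)
record RealField (c ℓ : Level) : Set (lsuc (c ⊔ ℓ)) where
  field
    commutativeRing : CommutativeRing c ℓ
  open CommutativeRing commutativeRing public
  field
    _≤_            : Carrier → Carrier → Set ℓ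
    ≤-isTotalOrder : IsTotalOrder _≈_ _≤_
    +-monoˡ-≤      : ∀ {x y} z → x ≤ y → (x + z) ≤ (y + z)
    *-nonneg       : ∀ {x y} → 0# ≤ x → 0# ≤ y → 0# ≤ (x * y)
    0≉1            : ¬ (0# ≈ 1#)
    inverse        : ∀ x → ¬ (x ≈ 0#) → Σ Carrier (λ y → (x * y) ≈ 1#)
    complete       : (P : Carrier → Set ℓ) → Σ Carrier P →
                     Σ Carrier (λ b → ∀ x → P x → x ≤ b) →
                     Σ Carrier (λ s → (∀ x → P x → x ≤ s) ×
                                      (∀ b → (∀ x → P x → x ≤ b) → s ≤ b))

module _ {c ℓ : Level} (R : RealField c ℓ) where
  open RealField R using (Carrier; _≈_; _+_; _*_; 0#)

  Matrix : ℕ → Set c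
  Matrix n = Fin n → Fin n → Carrier

  ∑ : ∀ {n} → (Fin n → Carrier) → Carrier
  ∑ {ℕ.zero}  f = 0#
  ∑ {ℕ.suc n} f = f Fin.zero + ∑ (λ i → f (Fin.suc i))

  _⊗_ : ∀ {n} → Matrix n → Matrix n → Matrix n
  (M ⊗ N) i j = ∑ (λ k → M i k * N k j)

  _≋_ : ∀ {n} → Matrix n → Matrix n → Set ℓ
  M ≋ N = ∀ i j → M i j ≈ N i j

  IsSymmetric : ∀ {n} → Matrix n → Set ℓ
  IsSymmetric A = ∀ i j → A i j ≈ A j i

  IsGroupInverse : ∀ {n} → Matrix n → Matrix n → Set ℓ
  IsGroupInverse A X = (((A ⊗ X) ⊗ A) ≋ A) × (((X ⊗ A) ⊗ X) ≋ X) × ((A ⊗ X) ≋ (X ⊗ A))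

  Edge : ∀ {n} → Matrix n → Fin n → Fin n → Set ℓ
  Edge M i j = ¬ (M i j ≈ 0#)

  data Walk {n} (M : Matrix n) : Fin n → Fin n → Set (c ⊔ ℓ) where
    here : ∀ {i} → Walk M i i
    step : ∀ {i j k} → Edge M i j → Walk M j k → Walk M i k

  Connected : ∀ {n} → Matrix n → Set (c ⊔ ℓ)
  Connected M = ∀ i j → Walk M i j

  Bipartite : ∀ {n} → Matrix n → Set ℓ
  Bipartite {n} M = Σ (Fin n → Bool) (λ col → ∀ i j → Edge M i j → col i ≢ col j)

{-# OPTIONS --safe #-}
-- Group inverses are unique, so every transformation of matrices that maps group-inverse pairs
-- to group-inverse pairs commutes with A ↦ A#.  Let D be the ±1 diagonal matrix of a 2-colouring
-- of the vertices.  Conjugation by D is such a transformation, and so is negation.  If A vanishes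
-- between the colour classes then DAD = A, hence DXD = X and X vanishes between them as well;
-- if A vanishes inside the classes then DAD = -A, hence DXD = -X and X vanishes inside them.
-- The second fact is (b).  For (a), colour by reachability from a vertex i in G#: X vanishes
-- between the classes, hence so does its group inverse A, and a walk in G from i never leaves
-- the class of i.  Reachability is decidable because edges are: Dedekind completeness yields
-- excluded middle for negated propositions, and an edge is the negation of a zero entry.
module Submission where

open import Defs
open import Level using (Level)
open import Function using (_∘_)
open import Function.Bundles using (Equivalence; mk⇔)
open import Data.Bool using (Bool; true; false; _≟_)
open import Data.Bool.Properties using (T-≡)
open import Data.Nat using (ℕ; zero; suc; z≤n; s≤s)
import Data.Nat as ℕ
open import Data.Nat.Properties using (<⇒≤)
open import Data.Fin using (Fin)
import Data.Fin as Fin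
open import Data.Fin.Properties using (any?; injective⇒≤)
open import Data.Product using (Σ; _×_; _,_; proj₁)
open import Data.Sum using (_⊎_; inj₁; inj₂; swap)
open import Data.Vec using (Vec; []; _∷_)
import Data.Vec.Relation.Unary.All as All
import Data.Vec.Relation.Unary.Any as Any
open import Data.Vec.Relation.Unary.AllPairs using ([]; _∷_)
open import Data.Vec.Membership.Propositional using (_∈_)
open import Data.Vec.Relation.Unary.Unique.Propositional using (Unique)
open import Data.Vec.Relation.Unary.Unique.Propositional.Properties using (lookup-injective)
import Data.Vec.Functional.Relation.Binary.Equality.Setoid as PointwiseEquality
open import Relation.Nullary using (¬_; Dec; yes; no; contradiction)
open import Relation.Nullary.Decidable
  using (does; map′; toSum; _×-dec_; toWitness; isYes≗does; dec-true; does-⇔; decidable-stable)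
open import Relation.Binary.Bundles using (Setoid)
open import Relation.Binary.Definitions using (Decidable)
open import Relation.Binary.Structures using (IsTotalOrder)
open import Relation.Binary.PropositionalEquality using (_≡_; _≢_; cong)
  renaming (refl to ≡-refl; sym to ≡-sym; trans to ≡-trans)
import Relation.Binary.Reasoning.Setoid as SetoidReasoning

module _ {c ℓ : Level} (R : RealField c ℓ) where
  open RealField R hiding (zero)
  open import Algebra.Properties.Semiring.Sum semiring
    using (sum; sum-cong-≋; ∑-comm; *-distribˡ-sum; *-distribʳ-sum)
  open import Algebra.Properties.Ring ring using (-1*x≈-x; -‿distribˡ-*; -‿distribʳ-*)
  open import Algebra.Properties.AbelianGroup +-abelianGroup
    using () renaming (⁻¹-involutive to -‿involutive; ε⁻¹≈ε to -0≈0)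
  open import Algebra.Solver.CommutativeMonoid *-commutativeMonoid
    using (solve; _⊕_; _⊜_)
  module ≈-Reasoning = SetoidReasoning setoid

  ∑≡sum : ∀ n → ∑ R {n} ≡ sum {n}
  ∑≡sum zero    = ≡-refl
  ∑≡sum (suc n) = cong (λ s f → f Fin.zero + s (λ i → f (Fin.suc i))) (∑≡sum n)

  infixl 7 _·_
  _·_ : ∀ {n} → Matrix R n → Matrix R n → Matrix R n
  _·_ = _⊗_ R

  infix 4 _≃_
  _≃_ : ∀ {n} → Matrix R n → Matrix R n → Set ℓ
  _≃_ = _≋_ R

  matrixSetoid : ℕ → Setoid c ℓ
  matrixSetoid n = PointwiseEquality.≋-setoid (PointwiseEquality.≋-setoid setoid n) n

  module ≃ {n} = Setoid (matrixSetoid n)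
  module ≃-Reasoning {n} = SetoidReasoning (matrixSetoid n)

  ·-cong : ∀ {n} {M M′ N N′ : Matrix R n} → M ≃ M′ → N ≃ N′ → M · N ≃ M′ · N′
  ·-cong {n} M≃M′ N≃N′ i j rewrite ∑≡sum n =
    sum-cong-≋ (λ k → *-cong (M≃M′ i k) (N≃N′ k j))

  ·-assoc : ∀ {n} (M N P : Matrix R n) → (M · N) · P ≃ M · (N · P)
  ·-assoc {n} M N P i j rewrite ∑≡sum n = begin
    sum (λ k → sum (λ l → M i l * N l k) * P k j)
      ≈⟨ sum-cong-≋ (λ k → *-distribʳ-sum (P k j) (λ l → M i l * N l k)) ⟩
    sum (λ k → sum (λ l → M i l * N l k * P k j))
      ≈⟨ ∑-comm (λ k l → M i l * N l k * P k j) ⟩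
    sum (λ l → sum (λ k → M i l * N l k * P k j))
      ≈⟨ sum-cong-≋ (λ l → sum-cong-≋ (λ k → *-assoc (M i l) (N l k) (P k j))) ⟩
    sum (λ l → sum (λ k → M i l * (N l k * P k j)))
      ≈⟨ sum-cong-≋ (λ l → sym (*-distribˡ-sum (M i l) (λ k → N l k * P k j))) ⟩
    sum (λ l → M i l * sum (λ k → N l k * P k j))
      ∎
    where open ≈-Reasoning

  _ᵀ : ∀ {n} → Matrix R n → Matrix R n
  (M ᵀ) i j = M j i

  ·-ᵀ : ∀ {n} (M N : Matrix R n) → (M · N) ᵀ ≃ N ᵀ · M ᵀ
  ·-ᵀ {n} M N i j rewrite ∑≡sum n = sum-cong-≋ (λ k → *-comm (M j k) (N k i))

  conj : ∀ {n} → (Fin n → Carrier) → Matrix R n → Matrix R n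
  conj d M i j = d i * M i j * d j

  conj-cong : ∀ {n} (d : Fin n → Carrier) {M N : Matrix R n} → M ≃ N → conj d M ≃ conj d N
  conj-cong d M≃N i j = *-cong (*-cong refl (M≃N i j)) refl

  conj-· : ∀ {n} {d : Fin n → Carrier} → (∀ k → d k * d k ≈ 1#) →
           (M N : Matrix R n) → conj d M · conj d N ≃ conj d (M · N)
  conj-· {n} {d} d²≈1 M N i j rewrite ∑≡sum n = begin
    sum (λ k → (d i * M i k * d k) * (d k * N k j * d j))
      ≈⟨ sum-cong-≋ cancel ⟩
    sum (λ k → d i * (M i k * N k j) * d j)
      ≈⟨ sym (*-distribʳ-sum (d j) (λ k → d i * (M i k * N k j))) ⟩
    sum (λ k → d i * (M i k * N k j)) * d j
      ≈⟨ *-cong (sym (*-distribˡ-sum (d i) (λ k → M i k * N k j))) refl ⟩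
    d i * sum (λ k → M i k * N k j) * d j
      ∎
    where
    open ≈-Reasoning
    cancel : ∀ k → (d i * M i k * d k) * (d k * N k j * d j) ≈ d i * (M i k * N k j) * d j
    cancel k = begin
      (d i * M i k * d k) * (d k * N k j * d j)
        ≈⟨ solve 5 (λ dᵢ Mᵢₖ dₖ Nₖⱼ dⱼ → ((dᵢ ⊕ Mᵢₖ) ⊕ dₖ) ⊕ ((dₖ ⊕ Nₖⱼ) ⊕ dⱼ)
                                         ⊜ ((dᵢ ⊕ (Mᵢₖ ⊕ Nₖⱼ)) ⊕ dⱼ) ⊕ (dₖ ⊕ dₖ))
                   refl (d i) (M i k) (d k) (N k j) (d j) ⟩
      (d i * (M i k * N k j) * d j) * (d k * d k)
        ≈⟨ *-cong refl (d²≈1 k) ⟩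
      (d i * (M i k * N k j) * d j) * 1#
        ≈⟨ *-identityʳ _ ⟩
      d i * (M i k * N k j) * d j
        ∎

  neg : ∀ {n} → Matrix R n → Matrix R n
  neg M i j = - M i j

  neg-cong : ∀ {n} {M N : Matrix R n} → M ≃ N → neg M ≃ neg N
  neg-cong M≃N i j = -‿cong (M≃N i j)

  ·-negʳ : ∀ {n} (M N : Matrix R n) → M · neg N ≃ neg (M · N)
  ·-negʳ {n} M N i j rewrite ∑≡sum n = begin
    sum (λ k → M i k * - N k j)
      ≈⟨ sum-cong-≋ (λ k → sym (-‿distribʳ-* (M i k) (N k j))) ⟩
    sum (λ k → - (M i k * N k j))
      ≈⟨ sum-cong-≋ (λ k → sym (-1*x≈-x (M i k * N k j))) ⟩
    sum (λ k → - 1# * (M i k * N k j))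
      ≈⟨ sym (*-distribˡ-sum (- 1#) (λ k → M i k * N k j)) ⟩
    - 1# * sum (λ k → M i k * N k j)
      ≈⟨ -1*x≈-x _ ⟩
    - sum (λ k → M i k * N k j)
      ∎
    where open ≈-Reasoning

  neg-·-neg : ∀ {n} (M N : Matrix R n) → neg M · neg N ≃ M · N
  neg-·-neg {n} M N i j rewrite ∑≡sum n = sum-cong-≋ (λ k → begin
    - M i k * - N k j     ≈⟨ sym (-‿distribʳ-* (- M i k) (N k j)) ⟩
    - (- M i k * N k j)   ≈⟨ -‿cong (sym (-‿distribˡ-* (M i k) (N k j))) ⟩
    - - (M i k * N k j)   ≈⟨ -‿involutive (M i k * N k j) ⟩
    M i k * N k j         ∎)
    where open ≈-Reasoning

  IsGroupInverse-resp : ∀ {n} {A A′ X X′ : Matrix R n} → A ≃ A′ → X ≃ X′ →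
                        IsGroupInverse R A X → IsGroupInverse R A′ X′
  IsGroupInverse-resp A≃A′ X≃X′ (AXA≃A , XAX≃X , AX≃XA) =
    ≃.trans (·-cong (·-cong (≃.sym A≃A′) (≃.sym X≃X′)) (≃.sym A≃A′)) (≃.trans AXA≃A A≃A′) ,
    ≃.trans (·-cong (·-cong (≃.sym X≃X′) (≃.sym A≃A′)) (≃.sym X≃X′)) (≃.trans XAX≃X X≃X′) ,
    ≃.trans (·-cong (≃.sym A≃A′) (≃.sym X≃X′)) (≃.trans AX≃XA (·-cong X≃X′ A≃A′))

  IsGroupInverse-sym : ∀ {n} {A X : Matrix R n} → IsGroupInverse R A X → IsGroupInverse R X A
  IsGroupInverse-sym (AXA≃A , XAX≃X , AX≃XA) = XAX≃X , AXA≃A , ≃.sym AX≃XA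

  groupInverse-unique : ∀ {n} {A X Y : Matrix R n} →
                        IsGroupInverse R A X → IsGroupInverse R A Y → X ≃ Y
  groupInverse-unique {A = A} {X} {Y} (AXA≃A , XAX≃X , AX≃XA) (AYA≃A , YAY≃Y , AY≃YA) = begin
    X               ≈⟨ ≃.sym XAX≃X ⟩
    (X · A) · X     ≈⟨ ·-assoc X A X ⟩
    X · (A · X)     ≈⟨ ·-cong ≃.refl AX≃AY ⟩
    X · (A · Y)     ≈⟨ ≃.sym (·-assoc X A Y) ⟩
    (X · A) · Y     ≈⟨ ·-cong (≃.sym AX≃XA) ≃.refl ⟩
    (A · X) · Y     ≈⟨ ·-cong AX≃AY ≃.refl ⟩
    (A · Y) · Y     ≈⟨ ·-cong AY≃YA ≃.refl ⟩
    (Y · A) · Y     ≈⟨ YAY≃Y ⟩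
    Y               ∎
    where
    open ≃-Reasoning
    AX≃AY : A · X ≃ A · Y
    AX≃AY = begin
      A · X               ≈⟨ ·-cong (≃.sym AYA≃A) ≃.refl ⟩
      (A · Y · A) · X     ≈⟨ ·-assoc (A · Y) A X ⟩
      (A · Y) · (A · X)   ≈⟨ ·-cong AY≃YA AX≃XA ⟩
      (Y · A) · (X · A)   ≈⟨ ·-assoc Y A (X · A) ⟩
      Y · (A · (X · A))   ≈⟨ ·-cong ≃.refl (≃.sym (·-assoc A X A)) ⟩
      Y · ((A · X) · A)   ≈⟨ ·-cong ≃.refl AXA≃A ⟩
      Y · A               ≈⟨ ≃.sym AY≃YA ⟩
      A · Y               ∎

  IsGroupInverse-ᵀ : ∀ {n} {A X : Matrix R n} →
                     IsGroupInverse R A X → IsGroupInverse R (A ᵀ) (X ᵀ)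
  IsGroupInverse-ᵀ {A = A} {X} (AXA≃A , XAX≃X , AX≃XA) =
    ≃.trans (≃.sym (·-·-ᵀ A X A)) (λ i j → AXA≃A j i) ,
    ≃.trans (≃.sym (·-·-ᵀ X A X)) (λ i j → XAX≃X j i) ,
    ≃.trans (≃.sym (·-ᵀ X A)) (≃.trans (λ i j → sym (AX≃XA j i)) (·-ᵀ A X))
    where
    ·-·-ᵀ : ∀ M N P → ((M · N) · P) ᵀ ≃ (P ᵀ · N ᵀ) · M ᵀ
    ·-·-ᵀ M N P = begin
      ((M · N) · P) ᵀ     ≈⟨ ·-ᵀ (M · N) P ⟩
      P ᵀ · (M · N) ᵀ     ≈⟨ ·-cong ≃.refl (·-ᵀ M N) ⟩
      P ᵀ · (N ᵀ · M ᵀ)   ≈⟨ ≃.sym (·-assoc (P ᵀ) (N ᵀ) (M ᵀ)) ⟩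
      (P ᵀ · N ᵀ) · M ᵀ   ∎
      where open ≃-Reasoning

  groupInverse-symmetric : ∀ {n} {A X : Matrix R n} →
                           IsSymmetric R A → IsGroupInverse R A X → IsSymmetric R X
  groupInverse-symmetric A-sym AX-inv =
    groupInverse-unique AX-inv (IsGroupInverse-resp (λ i j → A-sym j i) ≃.refl (IsGroupInverse-ᵀ AX-inv))

  IsGroupInverse-conj : ∀ {n} {d : Fin n → Carrier} {A X : Matrix R n} → (∀ k → d k * d k ≈ 1#) →
                        IsGroupInverse R A X → IsGroupInverse R (conj d A) (conj d X)
  IsGroupInverse-conj {d = d} {A} {X} d²≈1 (AXA≃A , XAX≃X , AX≃XA) =
    ≃.trans (·-cong (conj-· d²≈1 A X) ≃.refl) (≃.trans (conj-· d²≈1 (A · X) A) (conj-cong d AXA≃A)) ,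
    ≃.trans (·-cong (conj-· d²≈1 X A) ≃.refl) (≃.trans (conj-· d²≈1 (X · A) X) (conj-cong d XAX≃X)) ,
    ≃.trans (conj-· d²≈1 A X) (≃.trans (conj-cong d AX≃XA) (≃.sym (conj-· d²≈1 X A)))

  IsGroupInverse-neg : ∀ {n} {A X : Matrix R n} →
                       IsGroupInverse R A X → IsGroupInverse R (neg A) (neg X)
  IsGroupInverse-neg {A = A} {X} (AXA≃A , XAX≃X , AX≃XA) =
    ≃.trans (·-cong (neg-·-neg A X) ≃.refl) (≃.trans (·-negʳ (A · X) A) (neg-cong AXA≃A)) ,
    ≃.trans (·-cong (neg-·-neg X A) ≃.refl) (≃.trans (·-negʳ (X · A) X) (neg-cong XAX≃X)) ,
    ≃.trans (neg-·-neg A X) (≃.trans AX≃XA (≃.sym (neg-·-neg X A)))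

  module ≤ = IsTotalOrder ≤-isTotalOrder

  x≤0⇒0≤-x : ∀ {x} → x ≤ 0# → 0# ≤ (- x)
  x≤0⇒0≤-x {x} x≤0 = ≤.≲-respʳ-≈ (+-identityˡ (- x))
                       (≤.≲-respˡ-≈ (-‿inverseʳ x) (+-monoˡ-≤ (- x) x≤0))

  0≤x⇒-x≤0 : ∀ {x} → 0# ≤ x → (- x) ≤ 0#
  0≤x⇒-x≤0 {x} 0≤x = ≤.≲-respʳ-≈ (-‿inverseʳ x)
                       (≤.≲-respˡ-≈ (+-identityˡ (- x)) (+-monoˡ-≤ (- x) 0≤x))

  -1*-1≈1 : - 1# * - 1# ≈ 1#
  -1*-1≈1 = trans (-1*x≈-x (- 1#)) (-‿involutive 1#)

  0≤1 : 0# ≤ 1#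
  0≤1 with ≤.total 0# 1#
  ... | inj₁ 0≤1 = 0≤1
  ... | inj₂ 1≤0 = ≤.≲-respʳ-≈ -1*-1≈1 (*-nonneg 0≤-1 0≤-1)
    where 0≤-1 = x≤0⇒0≤-x 1≤0

  1≰0 : ¬ 1# ≤ 0#
  1≰0 1≤0 = 0≉1 (≤.antisym 0≤1 1≤0)

  0≰-1 : ¬ 0# ≤ (- 1#)
  0≰-1 0≤-1 = 1≰0 (≤.≲-respˡ-≈ (-‿involutive 1#) (0≤x⇒-x≤0 0≤-1))

  x≈-x⇒x≈0 : ∀ {x} → x ≈ - x → x ≈ 0#
  x≈-x⇒x≈0 {x} x≈-x with ≤.total x 0#
  ... | inj₁ x≤0 = ≤.antisym x≤0 (≤.≲-respʳ-≈ (sym x≈-x) (x≤0⇒0≤-x x≤0))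
  ... | inj₂ 0≤x = ≤.antisym (≤.≲-respˡ-≈ (sym x≈-x) (0≤x⇒-x≤0 0≤x)) 0≤x

  -- Compare the supremum s of {-1} ∪ {1 | Q} with 0: s ≤ 0 refutes Q and 0 ≤ s refutes ¬ Q.
  weak-excluded-middle : (Q : Set ℓ) → Dec (¬ Q)
  weak-excluded-middle Q = decide (complete P (- 1# , inj₁ refl) (1# , ≤1))
    where
    P : Carrier → Set ℓ
    P x = x ≈ - 1# ⊎ (x ≈ 1# × Q)

    ≤1 : ∀ x → P x → x ≤ 1#
    ≤1 x (inj₁ x≈-1)      = ≤.≲-respˡ-≈ (sym x≈-1) (≤.trans (0≤x⇒-x≤0 0≤1) 0≤1)
    ≤1 x (inj₂ (x≈1 , _)) = ≤.reflexive x≈1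

    decide : Σ Carrier (λ s → (∀ x → P x → x ≤ s) × (∀ b → (∀ x → P x → x ≤ b) → s ≤ b)) →
             Dec (¬ Q)
    decide (s , upper , least) with ≤.total s 0#
    ... | inj₁ s≤0 = yes (λ q → 1≰0 (≤.trans (upper 1# (inj₂ (refl , q))) s≤0))
    ... | inj₂ 0≤s = no (λ ¬q → 0≰-1 (≤.trans 0≤s (least (- 1#) (≤-1 ¬q))))
      where
      ≤-1 : ¬ Q → ∀ x → P x → x ≤ (- 1#)
      ≤-1 ¬q x (inj₁ x≈-1)    = ≤.reflexive x≈-1
      ≤-1 ¬q x (inj₂ (_ , q)) = contradiction q ¬q

  edge? : ∀ {n} (M : Matrix R n) → Decidable (Edge R M)
  edge? M i j = weak-excluded-middle (M i j ≈ 0#)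

  sign : Bool → Carrier
  sign true  = 1#
  sign false = - 1#

  sign²≈1 : ∀ b → sign b * sign b ≈ 1#
  sign²≈1 true  = *-identityˡ 1#
  sign²≈1 false = -1*-1≈1

  sign-conj-≡ : ∀ {b b′} (x : Carrier) → b ≡ b′ → sign b * x * sign b′ ≈ x
  sign-conj-≡ {true}  x ≡-refl = trans (*-identityʳ _) (*-identityˡ x)
  sign-conj-≡ {false} x ≡-refl = begin
    - 1# * x * - 1#    ≈⟨ *-cong (-1*x≈-x x) refl ⟩
    - x * - 1#         ≈⟨ sym (-‿distribʳ-* (- x) 1#) ⟩
    - (- x * 1#)       ≈⟨ -‿cong (*-identityʳ (- x)) ⟩
    - - x              ≈⟨ -‿involutive x ⟩
    x                  ∎
    where open ≈-Reasoning

  sign-conj-≢ : ∀ {b b′} (x : Carrier) → b ≢ b′ → sign b * x * sign b′ ≈ - x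
  sign-conj-≢ {true}  {true}  x b≢b′ = contradiction ≡-refl b≢b′
  sign-conj-≢ {true}  {false} x b≢b′ =
    trans (*-cong (*-identityˡ x) refl) (trans (sym (-‿distribʳ-* x 1#)) (-‿cong (*-identityʳ x)))
  sign-conj-≢ {false} {true}  x b≢b′ = trans (*-identityʳ _) (-1*x≈-x x)
  sign-conj-≢ {false} {false} x b≢b′ = contradiction ≡-refl b≢b′

  x≈0⇒x≈-x : ∀ {x} → x ≈ 0# → x ≈ - x
  x≈0⇒x≈-x {x} x≈0 = trans x≈0 (trans (sym -0≈0) (-‿cong (sym x≈0)))

  module _ {n} (col : Fin n → Bool) where

    BlockDiagonal : Matrix R n → Set ℓ
    BlockDiagonal M = ∀ p q → col p ≢ col q → M p q ≈ 0#

    BlockOffDiagonal : Matrix R n → Set ℓ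
    BlockOffDiagonal M = ∀ p q → col p ≡ col q → M p q ≈ 0#

    conj-sign-blockDiagonal : ∀ {M} → BlockDiagonal M → conj (sign ∘ col) M ≃ M
    conj-sign-blockDiagonal {M} M-bd p q with col p ≟ col q
    ... | yes same = sign-conj-≡ (M p q) same
    ... | no  diff = trans (sign-conj-≢ (M p q) diff) (sym (x≈0⇒x≈-x (M-bd p q diff)))

    conj-sign-blockOffDiagonal : ∀ {M} → BlockOffDiagonal M → conj (sign ∘ col) M ≃ neg M
    conj-sign-blockOffDiagonal {M} M-bod p q with col p ≟ col q
    ... | yes same = trans (sign-conj-≡ (M p q) same) (x≈0⇒x≈-x (M-bod p q same))
    ... | no  diff = sign-conj-≢ (M p q) diff

    groupInverse-blockDiagonal : ∀ {A X} → IsGroupInverse R A X → BlockDiagonal A → BlockDiagonal X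
    groupInverse-blockDiagonal {A} {X} AX-inv A-bd p q diff =
      x≈-x⇒x≈0 (trans (X≃conjX p q) (sign-conj-≢ (X p q) diff))
      where
      X≃conjX : X ≃ conj (sign ∘ col) X
      X≃conjX = groupInverse-unique AX-inv
        (IsGroupInverse-resp (conj-sign-blockDiagonal A-bd) ≃.refl
          (IsGroupInverse-conj (sign²≈1 ∘ col) AX-inv))

    groupInverse-blockOffDiagonal : ∀ {A X} → IsGroupInverse R A X → BlockOffDiagonal A →
                                    BlockOffDiagonal X
    groupInverse-blockOffDiagonal {A} {X} AX-inv A-bod p q same =
      x≈-x⇒x≈0 (trans (sym (sign-conj-≡ (X p q) same)) (sym (negX≃conjX p q)))
      where
      negX≃conjX : neg X ≃ conj (sign ∘ col) X
      negX≃conjX = groupInverse-unique (IsGroupInverse-neg AX-inv)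
        (IsGroupInverse-resp (conj-sign-blockOffDiagonal A-bod) ≃.refl
          (IsGroupInverse-conj (sign²≈1 ∘ col) AX-inv))

  module _ {n} (M : Matrix R n) where

    length : ∀ {i j} → Walk R M i j → ℕ
    length here       = zero
    length (step _ w) = suc (length w)

    vertices : ∀ {i j} (w : Walk R M i j) → Vec (Fin n) (suc (length w))
    vertices (here {i})     = i ∷ []
    vertices (step {i} _ w) = i ∷ vertices w

    suffixFrom : ∀ {i j v} (w : Walk R M i j) → v ∈ vertices w → Walk R M v j
    suffixFrom here       (Any.here ≡-refl) = here
    suffixFrom (step e w) (Any.here ≡-refl) = step e w
    suffixFrom (step e w) (Any.there v∈w)   = suffixFrom w v∈w

    suffixFrom-unique : ∀ {i j v} (w : Walk R M i j) (v∈w : v ∈ vertices w) →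
                        Unique (vertices w) → Unique (vertices (suffixFrom w v∈w))
    suffixFrom-unique here       (Any.here ≡-refl) u       = u
    suffixFrom-unique (step e w) (Any.here ≡-refl) u       = u
    suffixFrom-unique (step e w) (Any.there v∈w)   (_ ∷ u) = suffixFrom-unique w v∈w u

    simplify : ∀ {i j} → Walk R M i j → Σ (Walk R M i j) (Unique ∘ vertices)
    simplify here = here , All.[] ∷ []
    simplify (step {i} e w) with simplify w
    ... | w′ , w′-unique with All.decide (λ v → swap (toSum (i Fin.≟ v))) (vertices w′)
    ...   | inj₁ i∉w′ = step e w′ , i∉w′ ∷ w′-unique
    ...   | inj₂ i∈w′ = suffixFrom w′ i∈w′ , suffixFrom-unique w′ i∈w′ w′-unique

    unique-length< : ∀ {i j} (w : Walk R M i j) → Unique (vertices w) → length w ℕ.< n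
    unique-length< w u = injective⇒≤ (λ {x} {y} → lookup-injective u x y)

    shorten : ∀ {i j} → Walk R M i j → Σ (Walk R M i j) (λ w → length w ℕ.≤ n)
    shorten w with simplify w
    ... | w′ , w′-unique = w′ , <⇒≤ (unique-length< w′ w′-unique)

    boundedWalk? : ∀ k a b → Dec (Σ (Walk R M a b) (λ w → length w ℕ.≤ k))
    boundedWalk? k a b with a Fin.≟ b
    boundedWalk? k       a .a | yes ≡-refl = yes (here , z≤n)
    boundedWalk? zero    a b  | no a≢b     = no λ { (here , _) → a≢b ≡-refl ; (step _ _ , ()) }
    boundedWalk? (suc k) a b  | no a≢b
      with any? (λ u → edge? M a u ×-dec boundedWalk? k u b)
    ... | yes (u , e , w , |w|≤k) = yes (step e w , s≤s |w|≤k)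
    ... | no ∄u = no λ { (here , _) → a≢b ≡-refl
                       ; (step {j = u} e w , s≤s |w|≤k) → ∄u (u , e , w , |w|≤k) }

    walk? : Decidable (Walk R M)
    walk? a b = map′ proj₁ shorten (boundedWalk? n a b)

    walk-snoc : ∀ {i j k} → Walk R M i j → Edge R M j k → Walk R M i k
    walk-snoc here       e = step e here
    walk-snoc (step e′ w) e = step e′ (walk-snoc w e)

    walk-invariant : ∀ {b} {B : Set b} (f : Fin n → B) → (∀ {u v} → Edge R M u v → f u ≡ f v) →
                     ∀ {i j} → Walk R M i j → f i ≡ f j
    walk-invariant f f-edge here       = ≡-refl
    walk-invariant f f-edge (step e w) = ≡-trans (f-edge e) (walk-invariant f f-edge w)

  ¬¬-Π : ∀ {n p} {P : Fin n → Set p} → (∀ i → ¬ ¬ P i) → ¬ ¬ (∀ i → P i)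
  ¬¬-Π {zero}  _   ¬∀ = ¬∀ (λ ())
  ¬¬-Π {suc n} ¬¬P ¬∀ = ¬¬P Fin.zero λ P₀ → ¬¬-Π (¬¬P ∘ Fin.suc) λ P₊ →
    ¬∀ λ { Fin.zero → P₀ ; (Fin.suc i) → P₊ i }

  ¬¬-→ : ∀ {a b} {A : Set a} {B : Set b} → (A → ¬ ¬ B) → ¬ ¬ (A → B)
  ¬¬-→ f ¬[A→B] = ¬[A→B] λ a → contradiction (λ b → ¬[A→B] (λ _ → b)) (f a)

  -- The vanishing of X u v is only known up to double negation; this suffices because the
  -- conclusion drawn from it, an equality of Booleans, is decidable.
  connected-groupInverse : ∀ {n} {A X : Matrix R n} → IsSymmetric R A → IsGroupInverse R A X →
                           Connected R A → Connected R X
  connected-groupInverse {n} {A} {X} A-sym AX-inv A-conn i j =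
    toWitness {a? = walk? X i j}
      (Equivalence.from T-≡ (≡-trans (isYes≗does (walk? X i j)) reachable-j))
    where
    reachable : Fin n → Bool
    reachable v = does (walk? X i v)

    X-sym : IsSymmetric R X
    X-sym = groupInverse-symmetric A-sym AX-inv

    X-edge : ∀ {u v} → Edge R X u v → reachable u ≡ reachable v
    X-edge {u} {v} e =
      does-⇔ (mk⇔ (λ w → walk-snoc X w e) (λ w → walk-snoc X w (e ∘ trans (X-sym u v))))
             (walk? X i u) (walk? X i v)

    ¬¬X-bd : ¬ ¬ BlockDiagonal reachable X
    ¬¬X-bd = ¬¬-Π λ p → ¬¬-Π λ q → ¬¬-→ λ diff e → diff (X-edge e)

    A-edge : ∀ {u v} → Edge R A u v → reachable u ≡ reachable v
    A-edge {u} {v} e = decidable-stable (reachable u ≟ reachable v) λ diff →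
      ¬¬X-bd λ X-bd → e (groupInverse-blockDiagonal reachable (IsGroupInverse-sym AX-inv) X-bd u v diff)

    reachable-j : reachable j ≡ true
    reachable-j = ≡-trans (≡-sym (walk-invariant A reachable A-edge (A-conn i j)))
                          (dec-true (walk? X i i) here)

  bipartite-groupInverse : ∀ {n} {A X : Matrix R n} → IsGroupInverse R A X →
                           Bipartite R A → Bipartite R X
  bipartite-groupInverse {A = A} {X} AX-inv (col , A-proper) = col , X-proper
    where
    ¬¬A-bod : ¬ ¬ BlockOffDiagonal col A
    ¬¬A-bod = ¬¬-Π λ p → ¬¬-Π λ q → ¬¬-→ λ same e → A-proper p q e same

    X-proper : ∀ i j → Edge R X i j → col i ≢ col j
    X-proper i j e same = ¬¬A-bod λ A-bod → e (groupInverse-blockOffDiagonal col AX-inv A-bod i j same)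

proposition2p1 : ∀ {c ℓ : Level} (R : RealField c ℓ) (n : ℕ) (A X : Matrix R n) →
    IsSymmetric R A → IsGroupInverse R A X →
    (Connected R A → Connected R X) × (Bipartite R A → Bipartite R X)
proposition2p1 R n A X A-sym AX-inv =
  connected-groupInverse R A-sym AX-inv , bipartite-groupInverse R AX-inv
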